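{- For every integer $b \geq 2$, $\tau_0(2,b) = \lfloor\sqrt{b}\rfloor - 1$.
   Context: All graphs are finite and simple. For graphs $G,H$ on disjoint vertex sets, the join $G \vee H$ is the graph consisting of $G$, $H$, and all edges joining a vertex of $G$ to a vertex of $H$; $K_n$ is the complete graph on $n$ vertices, and $K_0 \vee G$ is understood as $G$. $K_{a,b}$ is the complete bipartite graph with partite sets of sizes $a$ and $b$. $\chi$ denotes chromatic number and $\chi_\ell$ list chromatic number. $\tau_0(a,b)$ (the Ohba number of $K_{a,b}$) denotes the smallest nonnegative integer $n$ such that $\chi_\ell(K_n \vee K_{a,b}) = \chi(K_n \vee K_{a,b})$. -}

module Defs where

open import Data.Nat using (ℕ; _<_; _≤_)
open import Data.Fin using (Fin)
open import Data.Sum using (_⊎_; inj₁; inj₂)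
open import Data.Product using (_×_; ∃)
open import Data.Unit using (⊤)
open import Data.Empty using (⊥)
open import Data.List using (List; length)
open import Data.List.Membership.Propositional using (_∈_)
open import Data.List.Relation.Unary.Unique.Propositional using (Unique)
open import Relation.Binary.PropositionalEquality using (_≡_; _≢_)
open import Relation.Nullary using (¬_)

-- A graph: a vertex type with an adjacency relation.
-- All graphs built below are finite and simple (symmetric, irreflexive).
record Graph : Set₁ where
  field
    V   : Set
    Adj : V → V → Set
open Graph public

K : ℕ → Graph
K n = record { V = Fin n ; Adj = λ i j → i ≢ j }

KBip : ℕ → ℕ → Graph
KBip a b = record { V = Fin a ⊎ Fin b ; Adj = adj }
  where
  adj : Fin a ⊎ Fin b → Fin a ⊎ Fin b → Set
  adj (inj₁ _) (inj₁ _) = ⊥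
  adj (inj₁ _) (inj₂ _) = ⊤
  adj (inj₂ _) (inj₁ _) = ⊤
  adj (inj₂ _) (inj₂ _) = ⊥

Join : Graph → Graph → Graph
Join G H = record { V = V G ⊎ V H ; Adj = adj }
  where
  adj : V G ⊎ V H → V G ⊎ V H → Set
  adj (inj₁ x) (inj₁ y) = Adj G x y
  adj (inj₁ _) (inj₂ _) = ⊤
  adj (inj₂ _) (inj₁ _) = ⊤
  adj (inj₂ x) (inj₂ y) = Adj H x y

Colorable : Graph → ℕ → Set
Colorable G k = ∃ λ (c : V G → Fin k) → ∀ u v → Adj G u v → c u ≢ c v

Choosable : Graph → ℕ → Set
Choosable G k =
  (L : V G → List ℕ) → (∀ v → Unique (L v)) → (∀ v → k ≤ length (L v)) →
  ∃ λ (c : V G → ℕ) → (∀ v → c v ∈ L v) × (∀ u v → Adj G u v → c u ≢ c v)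

IsChromaticNumber : Graph → ℕ → Set
IsChromaticNumber G k = Colorable G k × (∀ m → m < k → ¬ Colorable G m)

IsListChromaticNumber : Graph → ℕ → Set
IsListChromaticNumber G k = Choosable G k × (∀ m → m < k → ¬ Choosable G m)

ChiEq : Graph → Set
ChiEq G = ∃ λ k → IsChromaticNumber G k × IsListChromaticNumber G k

IsOhbaNumber : ℕ → ℕ → ℕ → Set
IsOhbaNumber a b n =
  ChiEq (Join (K n) (KBip a b)) × (∀ m → m < n → ¬ ChiEq (Join (K m) (KBip a b)))

-- Write k = n + 2. The graph K_n ∨ K_{2,b} contains a k-clique and is k-colourable, so χ = k.
--
-- Upper bound, b < k²: take lists of size k. If the two vertices u₁, u₂ of the 2-side share a
-- colour, use it for both and colour the rest greedily. Otherwise shrink every list of the b-side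
-- to a k-set and keep only an antichain of them; it remains to colour K_n, u₁, u₂ so that each of
-- these fewer than |L u₁| |L u₂| k-sets keeps a free colour. By induction on n: colouring the first
-- vertex of K_n with c deletes c from all lists, the k-sets through c become (k-1)-sets (the link
-- of c) and the others stay harmless. Among any k colours c of that vertex one has
-- |link c| < |L u₁ ∖ c| |L u₂ ∖ c|, by double counting: Σ_c |L u₁ ∖ c| |L u₂ ∖ c| is at least
-- (k-1) |L u₁| |L u₂|, while Σ_c |link c| = Σ_w |w ∩ {c₁, …, c_k}| ≤ (k-1) |W| + 1 because at
-- most one k-set of an antichain contains {c₁, …, c_k}. For n = 0 each 2-set rules out only one
-- pair (x, y) ∈ L u₁ × L u₂.
--
-- Lower bound, k² ≤ b: the k-1 vertices of K_n and u₁ get {0, …, k-1}, u₂ gets {k, …, 2k-1}, and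
-- for all i, t < k some vertex of the b-side gets {k+t} ∪ ({0, …, k-1} ∖ i).
--
-- Hence for s² ≤ b < (s+1)², K_{s-1} ∨ K_{2,b} has χ_ℓ = χ, while K_m ∨ K_{2,b} with m < s - 1
-- does not.

module Submission where

open import Defs

open import Level using (Level)
open import Function using (_∘_; flip)
open import Data.Empty using (⊥)
open import Data.Unit using (tt)
open import Data.Product using (_×_; _,_; proj₁; proj₂; ∃; ∃₂)
open import Data.Sum using (inj₁; inj₂)
open import Data.Nat as ℕ using (ℕ; zero; suc; _+_; _*_; _∸_; _/_; _%_; _≤_; _<_; _⊔_; z≤n; s≤s; _<?_; NonZero)
open import Data.Nat.Properties
open import Algebra.Properties.CommutativeSemigroup +-commutativeSemigroup using (interchange)
open import Data.Nat.DivMod using ([m+kn]%n≡m%n; m<n⇒m%n≡m; +-distrib-/; m<n⇒m/n≡0; m*n/n≡m; m*n%n≡0)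
open import Data.Nat.ListAction using (sum)
open import Data.Fin as Fin using (Fin; zero; suc; toℕ; fromℕ<)
open import Data.Fin.Properties using (pigeonhole)
import Data.Fin.Properties as Finₚ
open import Data.List using (List; []; _∷_; length; map; filter; lookup; cartesianProduct; _++_; take; deduplicate; tabulate; upTo)
open import Data.List.Properties using (length-upTo; length-tabulate; length-++; length-map; length-filter; length-take; length-deduplicate; map-cong; filter-all; filter-notAll)
open import Data.List.Membership.Propositional using (_∈_; _∉_; find; lose)
open import Data.List.Membership.Propositional.Properties using (∈-lookup; ∈-upTo⁺; ∈-upTo⁻; ∈-tabulate⁺; ∈-tabulate⁻; ∈-cartesianProduct⁻; ∈-filter⁺; ∈-filter⁻; ∈-map⁺; ∈-map⁻)
open import Data.List.Relation.Unary.Any as Any using (Any; here; there)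
import Data.List.Relation.Unary.Any.Properties as Anyₚ
open import Data.List.Relation.Unary.All as All using (All; []; _∷_)
import Data.List.Relation.Unary.All.Properties as Allₚ
open Allₚ using (¬Any⇒All¬; ¬All⇒Any¬)
open import Data.List.Relation.Unary.AllPairs using (AllPairs; []; _∷_)
import Data.List.Relation.Unary.AllPairs.Properties as AllPairsₚ
open import Data.List.Relation.Unary.Unique.Propositional using (Unique)
import Data.List.Relation.Unary.Unique.Propositional.Properties as Unique
open import Data.List.Relation.Binary.Subset.Propositional using (_⊆_)
open import Data.List.Relation.Binary.Subset.Propositional.Properties using (Any-resp-⊆)
open import Data.List.Relation.Binary.Subset.Setoid.Properties using (Sublist⇒Subset)
open import Data.List.Relation.Binary.Sublist.Setoid.Properties using (take-⊆)
open import Data.List.Relation.Binary.Disjoint.Propositional using (Disjoint)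
open import Relation.Unary using (Pred) renaming (Decidable to Decidable₁)
open import Relation.Binary.Core using (Rel; REL)
open import Relation.Binary.Definitions using (Decidable; DecidableEquality; tri<; tri≈; tri>)
open import Relation.Binary.PropositionalEquality using (setoid; _≡_; _≢_; ≢-sym; refl; sym; trans; cong; cong₂; subst; subst₂; module ≡-Reasoning)
open import Relation.Nullary using (¬_; Dec; yes; no; ¬?; contradiction)
open import Relation.Nullary.Decidable using (decidable-stable)

private variable
  a b p r : Level
  A B : Set a
  xs ys : List A

lookup-injective : Unique xs → ∀ {i j} → lookup xs i ≡ lookup xs j → i ≡ j
lookup-injective (_ ∷ _) {zero} {zero} _ = refl
lookup-injective (x≢ ∷ _) {zero} {suc j} eq = contradiction eq (All.lookup x≢ (∈-lookup j))
lookup-injective (x≢ ∷ _) {suc i} {zero} eq = contradiction (sym eq) (All.lookup x≢ (∈-lookup i))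
lookup-injective (_ ∷ u) {suc i} {suc j} eq = cong suc (lookup-injective u eq)

injective-cover⇒length≤ : {R : REL A B r} → Unique xs →
  (∀ {x} → x ∈ xs → Any (R x) ys) →
  (∀ {x x′ y} → x ∈ xs → x′ ∈ xs → y ∈ ys → R x y → R x′ y → x ≡ x′) →
  length xs ≤ length ys
injective-cover⇒length≤ {xs = xs} {ys = ys} {R = R} u cover injective = ≮⇒≥ λ ys<xs →
  let i , j , i<j , same = pigeonhole ys<xs position
  in Finₚ.<⇒≢ i<j (lookup-injective u (injective (∈-lookup i) (∈-lookup j) (∈-lookup (position j))
       (subst (R (lookup xs i) ∘ lookup ys) same (Anyₚ.lookup-index (cover (∈-lookup i))))
       (Anyₚ.lookup-index (cover (∈-lookup j)))))
  where
  position : Fin (length xs) → Fin (length ys)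
  position i = Any.index (cover (∈-lookup i))

Unique⇒length≤ : Unique xs → xs ⊆ ys → length xs ≤ length ys
Unique⇒length≤ u xs⊆ys = injective-cover⇒length≤ u xs⊆ys (λ _ _ _ x≡y x′≡y → trans x≡y (sym x′≡y))

take⊆ : ∀ k (xs : List A) → take k xs ⊆ xs
take⊆ {A = A} k xs = Sublist⇒Subset (setoid A) (take-⊆ (setoid A) k xs)

deduplicate-¬R : {R : Rel A r} (R? : Decidable R) (xs : List A) →
  AllPairs (λ x y → ¬ R x y) (deduplicate R? xs)
deduplicate-¬R R? [] = []
deduplicate-¬R R? (x ∷ xs) =
  Allₚ.all-filter (¬? ∘ R? x) (deduplicate R? xs) ∷
  AllPairsₚ.filter⁺ (¬? ∘ R? x) (deduplicate-¬R R? xs)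

length-cartesianProduct : (xs : List A) (ys : List B) →
  length (cartesianProduct xs ys) ≡ length xs * length ys
length-cartesianProduct [] ys = refl
length-cartesianProduct (x ∷ xs) ys = begin
  length (map (x ,_) ys ++ cartesianProduct xs ys)
    ≡⟨ length-++ (map (x ,_) ys) ⟩
  length (map (x ,_) ys) + length (cartesianProduct xs ys)
    ≡⟨ cong₂ _+_ (length-map (x ,_) ys) (length-cartesianProduct xs ys) ⟩
  length ys + length xs * length ys                         ∎
  where open ≡-Reasoning

-- Sums and double counting

count : {P : Pred A p} → Decidable₁ P → List A → ℕ
count P? xs = length (filter P? xs)

indicator : {P : Set p} → Dec P → ℕ
indicator (yes _) = 1
indicator (no _) = 0

count-∷ : {P : Pred A p} (P? : Decidable₁ P) (x : A) (xs : List A) →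
  count P? (x ∷ xs) ≡ indicator (P? x) + count P? xs
count-∷ P? x xs with P? x
... | yes _ = refl
... | no _ = refl

sum-map-+ : (f g : A → ℕ) (xs : List A) →
  sum (map (λ x → f x + g x) xs) ≡ sum (map f xs) + sum (map g xs)
sum-map-+ f g [] = refl
sum-map-+ f g (x ∷ xs) = begin
  f x + g x + sum (map (λ x → f x + g x) xs)     ≡⟨ cong (f x + g x +_) (sum-map-+ f g xs) ⟩
  f x + g x + (sum (map f xs) + sum (map g xs))  ≡⟨ interchange (f x) (g x) _ _ ⟩
  f x + sum (map f xs) + (g x + sum (map g xs))  ∎
  where open ≡-Reasoning

sum-map-mono : {f g : A → ℕ} → All (λ x → f x ≤ g x) xs → sum (map f xs) ≤ sum (map g xs)
sum-map-mono [] = z≤n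
sum-map-mono (fx≤gx ∷ f≤g) = +-mono-≤ fx≤gx (sum-map-mono f≤g)

sum-map-const : (m : ℕ) (xs : List A) → sum (map (λ _ → m) xs) ≡ length xs * m
sum-map-const m [] = refl
sum-map-const m (x ∷ xs) = cong (m +_) (sum-map-const m xs)

sum-indicator : {P : Pred A p} (P? : Decidable₁ P) (xs : List A) →
  sum (map (indicator ∘ P?) xs) ≡ count P? xs
sum-indicator P? [] = refl
sum-indicator P? (x ∷ xs) =
  trans (cong (indicator (P? x) +_) (sum-indicator P? xs)) (sym (count-∷ P? x xs))

sum-count-comm : {R : REL A B r} (R? : Decidable R) (xs : List A) (ys : List B) →
  sum (map (λ x → count (R? x) ys) xs) ≡ sum (map (λ y → count (flip R? y) xs) ys)
sum-count-comm R? [] ys = trans (sym (*-zeroʳ (length ys))) (sym (sum-map-const 0 ys))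
sum-count-comm R? (x ∷ xs) ys = begin
  count (R? x) ys + sum (map (λ x → count (R? x) ys) xs)
    ≡⟨ cong₂ _+_ (sym (sum-indicator (R? x) ys)) (sum-count-comm R? xs ys) ⟩
  sum (map (indicator ∘ R? x) ys) + sum (map (λ y → count (flip R? y) xs) ys)
    ≡⟨ sum-map-+ (indicator ∘ R? x) (λ y → count (flip R? y) xs) ys ⟨
  sum (map (λ y → indicator (R? x y) + count (flip R? y) xs) ys)
    ≡⟨ cong sum (map-cong (λ y → sym (count-∷ (flip R? y) x xs)) ys) ⟩
  sum (map (λ y → count (flip R? y) (x ∷ xs)) ys)                              ∎
  where open ≡-Reasoning

k*[m⊔n]≤m*n : ∀ {k m n} → k ≤ m → k ≤ n → k * (m ⊔ n) ≤ m * n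
k*[m⊔n]≤m*n {k} {m} {n} k≤m k≤n with ≤-total m n
... | inj₁ m≤n = begin
  k * (m ⊔ n)  ≡⟨ cong (k *_) (m≤n⇒m⊔n≡n m≤n) ⟩
  k * n        ≤⟨ *-monoˡ-≤ n k≤m ⟩
  m * n        ∎
  where open ≤-Reasoning
... | inj₂ n≤m = begin
  k * (m ⊔ n)  ≡⟨ cong (k *_) (m≥n⇒m⊔n≡m n≤m) ⟩
  k * m        ≤⟨ *-monoˡ-≤ m k≤n ⟩
  n * m        ≡⟨ *-comm n m ⟩
  m * n        ∎
  where open ≤-Reasoning

[2+k]*m≤n*[2+k]+1⇒m≤n : ∀ k {m n} → (2 + k) * m ≤ n * (2 + k) + 1 → m ≤ n
[2+k]*m≤n*[2+k]+1⇒m≤n k {m} {n} km≤nk+1 = ≮⇒≥ λ n<m →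
  <⇒≱ (s≤s (s≤s z≤n)) (+-cancelˡ-≤ ((2 + k) * n) (2 + k) 1 (begin
  (2 + k) * n + (2 + k)  ≡⟨ +-comm _ (2 + k) ⟩
  (2 + k) + (2 + k) * n  ≡⟨ *-suc (2 + k) n ⟨
  (2 + k) * suc n        ≤⟨ *-monoʳ-≤ (2 + k) n<m ⟩
  (2 + k) * m            ≤⟨ km≤nk+1 ⟩
  n * (2 + k) + 1        ≡⟨ cong (_+ 1) (*-comm n (2 + k)) ⟩
  (2 + k) * n + 1        ∎))
  where open ≤-Reasoning

[t+z*k]%k≡t : ∀ {k t} .{{_ : NonZero k}} (z : ℕ) → t < k → (t + z * k) % k ≡ t
[t+z*k]%k≡t {k} {t} z t<k = trans ([m+kn]%n≡m%n t z k) (m<n⇒m%n≡m t<k)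

[t+z*k]/k≡z : ∀ {k t} .{{_ : NonZero k}} (z : ℕ) → t < k → (t + z * k) / k ≡ z
[t+z*k]/k≡z {k} {t} z t<k = begin
  (t + z * k) / k    ≡⟨ +-distrib-/ t (z * k) remainders<k ⟩
  t / k + z * k / k  ≡⟨ cong₂ _+_ (m<n⇒m/n≡0 t<k) (m*n/n≡m z k) ⟩
  z                  ∎
  where
  open ≡-Reasoning
  remainders<k : t % k + z * k % k < k
  remainders<k = subst₂ (λ r s → r + s < k) (sym (m<n⇒m%n≡m t<k)) (sym (m*n%n≡0 z k))
    (subst (_< k) (sym (+-identityʳ t)) t<k)

module ListColouring {a} {A : Set a} (_≟_ : DecidableEquality A) where

  open import Data.List.Membership.DecPropositional _≟_ using (_∈?_)
  open import Data.List.Relation.Binary.Subset.DecPropositional _≟_ using (_⊆?_)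

  private variable
    k : ℕ
    c z : A
    u v w X Y : List A
    W : List (List A)

  ¬⊆⇒Any∉ : ¬ u ⊆ v → Any (_∉ v) u
  ¬⊆⇒Any∉ {u} {v} u⊈v with Any.any? (λ z → ¬? (z ∈? v)) u
  ... | yes some = some
  ... | no none = contradiction
    (λ {z} z∈u → decidable-stable (_ ∈? v) (All.lookup (¬Any⇒All¬ u none) z∈u)) u⊈v

  Unique⇒Any∉ : Unique u → length v < length u → Any (_∉ v) u
  Unique⇒Any∉ unique v<u = ¬⊆⇒Any∉ (λ u⊆v → <⇒≱ v<u (Unique⇒length≤ unique u⊆v))

  ⊆∧length≥⇒⊇ : Unique u → u ⊆ v → length v ≤ length u → v ⊆ u
  ⊆∧length≥⇒⊇ {u} {v} unique u⊆v v≤u {z} z∈v with z ∈? u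
  ... | yes z∈u = z∈u
  ... | no z∉u = contradiction (Unique⇒length≤ (¬Any⇒All¬ u z∉u ∷ unique) z∷u⊆v) (<⇒≱ (s≤s v≤u))
    where
    z∷u⊆v : z ∷ u ⊆ v
    z∷u⊆v (here refl) = z∈v
    z∷u⊆v (there z∈u) = u⊆v z∈u

  infixl 6 _∖_
  _∖_ : List A → A → List A
  u ∖ c = filter (λ z → ¬? (z ≟ c)) u

  ∈-∖⁻ : z ∈ u ∖ c → z ∈ u × z ≢ c
  ∈-∖⁻ = ∈-filter⁻ (λ z → ¬? (z ≟ _))

  ∈-∖⁺ : z ∈ u → z ≢ c → z ∈ u ∖ c
  ∈-∖⁺ = ∈-filter⁺ (λ z → ¬? (z ≟ _))

  ∖-Unique : Unique u → Unique (u ∖ c)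
  ∖-Unique = Unique.filter⁺ (λ z → ¬? (z ≟ _))

  ∖-∉ : c ∉ u → u ∖ c ≡ u
  ∖-∉ {c} {u} c∉u = filter-all (λ z → ¬? (z ≟ c)) (All.map (_∘ sym) (¬Any⇒All¬ u c∉u))

  length≤1+length-∖ : Unique u → length u ≤ suc (length (u ∖ c))
  length≤1+length-∖ {u} {c} unique = Unique⇒length≤ unique u⊆c∷u∖c
    where
    u⊆c∷u∖c : u ⊆ c ∷ u ∖ c
    u⊆c∷u∖c {z} z∈u with z ≟ c
    ... | yes z≡c = here z≡c
    ... | no z≢c = there (∈-∖⁺ z∈u z≢c)

  length-∖<length : Unique u → c ∈ u → length (u ∖ c) < length u
  length-∖<length {u} {c} unique c∈u = Unique⇒length≤ (c∉u∖c ∷ ∖-Unique unique) c∷u∖c⊆u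
    where
    c∉u∖c : All (c ≢_) (u ∖ c)
    c∉u∖c = All.tabulate (λ z∈ c≡z → proj₂ (∈-∖⁻ {u = u} z∈) (sym c≡z))
    c∷u∖c⊆u : c ∷ u ∖ c ⊆ u
    c∷u∖c⊆u (here refl) = c∈u
    c∷u∖c⊆u (there z∈) = proj₁ (∈-∖⁻ {u = u} z∈)

  Disjoint-∖ : Disjoint X Y → Disjoint (X ∖ c) (Y ∖ c)
  Disjoint-∖ {X} {Y} X#Y (z∈X∖c , z∈Y∖c) =
    X#Y (proj₁ (∈-∖⁻ {u = X} z∈X∖c) , proj₁ (∈-∖⁻ {u = Y} z∈Y∖c))

  -- Palettes, k-sets and links

  Palette : ℕ → List A → Set a
  Palette k u = Unique u × k ≤ length u

  KSet : ℕ → List A → Set a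
  KSet k u = Unique u × length u ≡ k

  KSet⇒Palette : KSet k u → Palette k u
  KSet⇒Palette (unique , |u|≡k) = unique , ≤-reflexive (sym |u|≡k)

  Palette-∖ : Palette (suc k) u → Palette k (u ∖ c)
  Palette-∖ (unique , k<u) = ∖-Unique unique , ≤-pred (≤-trans k<u (length≤1+length-∖ unique))

  KSet-∖ : KSet (suc k) u → c ∈ u → KSet k (u ∖ c)
  KSet-∖ (unique , |u|≡1+k) c∈u = ∖-Unique unique , suc-injective (trans
    (≤-antisym (length-∖<length unique c∈u) (length≤1+length-∖ unique)) |u|≡1+k)

  link : A → List (List A) → List (List A)
  link c W = map (_∖ c) (filter (c ∈?_) W)

  ∈-link⁺ : w ∈ W → c ∈ w → w ∖ c ∈ link c W
  ∈-link⁺ w∈W c∈w = ∈-map⁺ (_∖ _) (∈-filter⁺ (_ ∈?_) w∈W c∈w)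

  ∈-link⁻ : v ∈ link c W → ∃ λ w → w ∈ W × c ∈ w × v ≡ w ∖ c
  ∈-link⁻ v∈ with w , w∈ , refl ← ∈-map⁻ (_∖ _) v∈ =
    let w∈W , c∈w = ∈-filter⁻ (_ ∈?_) w∈ in w , w∈W , c∈w , refl

  link-All : {P Q : Pred (List A) a} → (∀ {w} → P w → c ∈ w → Q (w ∖ c)) → All P W → All Q (link c W)
  link-All {c = c} {W = W} {Q = Q} P⇒Q all-P = All.tabulate Q-link
    where
    Q-link : v ∈ link c W → Q v
    Q-link v∈ with w , w∈W , c∈w , refl ← ∈-link⁻ v∈ = P⇒Q (All.lookup all-P w∈W) c∈w

  length-link : (c : A) (W : List (List A)) → length (link c W) ≡ count (c ∈?_) W
  length-link c W = length-map (_∖ c) (filter (c ∈?_) W)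

  Antichain : List (List A) → Set a
  Antichain = AllPairs (λ u v → ¬ u ⊆ v)

  ∖-⊆-reflect : c ∈ v → u ∖ c ⊆ v ∖ c → u ⊆ v
  ∖-⊆-reflect {c} {v} {u} c∈v sub {z} z∈u with z ≟ c
  ... | yes refl = c∈v
  ... | no z≢c = proj₁ (∈-∖⁻ {u = v} (sub (∈-∖⁺ z∈u z≢c)))

  link-Antichain : Antichain W → Antichain (link c W)
  link-Antichain {[]} [] = []
  link-Antichain {w ∷ W} {c} (w⊈ ∷ antichain) with c ∈? w
  ... | yes _ = All.tabulate w∖c⊈ ∷ link-Antichain antichain
    where
    w∖c⊈ : v ∈ link c W → ¬ w ∖ c ⊆ v
    w∖c⊈ v∈ with v , v∈W , c∈v , refl ← ∈-link⁻ v∈ = All.lookup w⊈ v∈W ∘ ∖-⊆-reflect c∈v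
  ... | no _ = link-Antichain antichain

  count-∈-⊈ : length u ≡ suc k → ¬ u ⊆ w → count (_∈? w) u ≤ k
  count-∈-⊈ {u} {w = w} |u|≡1+k u⊈w =
    ≤-pred (≤-trans (filter-notAll (_∈? w) u (¬⊆⇒Any∉ u⊈w)) (≤-reflexive |u|≡1+k))

  sum-count-∈-⊈ : length u ≡ suc k → All (λ w → ¬ u ⊆ w) W →
    sum (map (λ w → count (_∈? w) u) W) ≤ length W * k
  sum-count-∈-⊈ {u} {k} {W} |u|≡1+k u⊈W = begin
    sum (map (λ w → count (_∈? w) u) W)  ≤⟨ sum-map-mono (All.map (count-∈-⊈ |u|≡1+k) u⊈W) ⟩
    sum (map (λ _ → k) W)                ≡⟨ sum-map-const k W ⟩
    length W * k                         ∎
    where open ≤-Reasoning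

  sum-count-∈-Antichain : KSet (suc k) u → All (λ w → length w ≤ suc k) W → Antichain W →
    sum (map (λ w → count (_∈? w) u) W) ≤ length W * k + 1
  sum-count-∈-Antichain _ [] [] = z≤n
  sum-count-∈-Antichain {k} {u} {w ∷ W} ku@(unique , |u|≡1+k) (|w|≤1+k ∷ |W|≤1+k) (w⊈ ∷ antichain)
    with u ⊆? w
  ... | yes u⊆w = begin
    count (_∈? w) u + sum (map (λ w → count (_∈? w) u) W)
      ≤⟨ +-mono-≤ (length-filter (_∈? w) u) (sum-count-∈-⊈ |u|≡1+k u⊈W) ⟩
    length u + length W * k                                ≡⟨ cong (_+ length W * k) |u|≡1+k ⟩
    suc k + length W * k                                   ≡⟨ +-comm 1 (k + length W * k) ⟩
    k + length W * k + 1                                   ∎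
    where
    open ≤-Reasoning
    w⊆u : w ⊆ u
    w⊆u = ⊆∧length≥⇒⊇ unique u⊆w (subst (length w ≤_) (sym |u|≡1+k) |w|≤1+k)
    u⊈W : All (λ v → ¬ u ⊆ v) W
    u⊈W = All.map (λ w⊈v u⊆v → w⊈v (λ z∈w → u⊆v (w⊆u z∈w))) w⊈
  ... | no u⊈w = begin
    count (_∈? w) u + sum (map (λ w → count (_∈? w) u) W)
      ≤⟨ +-mono-≤ (count-∈-⊈ |u|≡1+k u⊈w) (sum-count-∈-Antichain ku |W|≤1+k antichain) ⟩
    k + (length W * k + 1)                                 ≡⟨ +-assoc k _ 1 ⟨
    k + length W * k + 1                                   ∎
    where open ≤-Reasoning

  product-≤-∖ˡ : Unique u → c ∉ v → length u * length v ≤ length (u ∖ c) * length (v ∖ c) + length v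
  product-≤-∖ˡ {u} {c} {v} unique c∉v = begin
    length u * length v                          ≤⟨ *-monoˡ-≤ (length v) (length≤1+length-∖ unique) ⟩
    length v + length (u ∖ c) * length v         ≡⟨ +-comm (length v) _ ⟩
    length (u ∖ c) * length v + length v
      ≡⟨ cong (λ v′ → length (u ∖ c) * length v′ + length v) (∖-∉ c∉v) ⟨
    length (u ∖ c) * length (v ∖ c) + length v   ∎
    where open ≤-Reasoning

  product-≤-∖ : Unique u → Unique v → ¬ (c ∈ u × c ∈ v) →
    length u * length v ≤ length (u ∖ c) * length (v ∖ c) + (length u ⊔ length v)
  product-≤-∖ {u} {v} {c} unique-u unique-v not-both with c ∈? v
  ... | no c∉v = ≤-trans (product-≤-∖ˡ unique-u c∉v) (+-monoʳ-≤ _ (m≤n⊔m (length u) (length v)))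
  ... | yes c∈v = begin
    length u * length v                          ≡⟨ *-comm (length u) (length v) ⟩
    length v * length u                          ≤⟨ product-≤-∖ˡ unique-v (λ c∈u → not-both (c∈u , c∈v)) ⟩
    length (v ∖ c) * length (u ∖ c) + length u   ≡⟨ cong (_+ length u) (*-comm (length (v ∖ c)) _) ⟩
    length (u ∖ c) * length (v ∖ c) + length u   ≤⟨ +-monoʳ-≤ _ (m≤m⊔n (length u) (length v)) ⟩
    length (u ∖ c) * length (v ∖ c) + (length u ⊔ length v) ∎
    where open ≤-Reasoning

  large-links⇒length≥ : KSet (3 + k) u → Palette (3 + k) X → Palette (3 + k) Y → Disjoint X Y →
    All (KSet (3 + k)) W → Antichain W →
    All (λ c → length (X ∖ c) * length (Y ∖ c) ≤ length (link c W)) u →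
    length X * length Y ≤ length W
  large-links⇒length≥ {k} {u} {X} {Y} {W} ku@(_ , |u|≡3+k) (unique-X , k≤X) (unique-Y , k≤Y) X#Y kW antichain
    large-links = [2+k]*m≤n*[2+k]+1⇒m≤n k (begin
      (2 + k) * (length X * length Y)                ≤⟨ products-≥ ⟩
      Σ                                              ≤⟨ sum-map-mono large-links ⟩
      sum (map (λ c → length (link c W)) u)          ≡⟨ cong sum (map-cong (λ c → length-link c W) u) ⟩
      sum (map (λ c → count (c ∈?_) W) u)            ≡⟨ sum-count-comm _∈?_ u W ⟩
      sum (map (λ w → count (_∈? w) u) W)
        ≤⟨ sum-count-∈-Antichain ku (All.map (≤-reflexive ∘ proj₂) kW) antichain ⟩
      length W * (2 + k) + 1                         ∎)
    where
    open ≤-Reasoning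
    Σ : ℕ
    Σ = sum (map (λ c → length (X ∖ c) * length (Y ∖ c)) u)
    products-≥ : (2 + k) * (length X * length Y) ≤ Σ
    products-≥ = +-cancelˡ-≤ (length X * length Y) _ _ (begin
      (3 + k) * (length X * length Y)                ≡⟨ cong (_* _) |u|≡3+k ⟨
      length u * (length X * length Y)               ≡⟨ sum-map-const _ u ⟨
      sum (map (λ _ → length X * length Y) u)
        ≤⟨ sum-map-mono (All.universal (λ c → product-≤-∖ unique-X unique-Y X#Y) u) ⟩
      sum (map (λ c → length (X ∖ c) * length (Y ∖ c) + (length X ⊔ length Y)) u)
                                                     ≡⟨ sum-map-+ _ _ u ⟩
      Σ + sum (map (λ _ → length X ⊔ length Y) u)
        ≡⟨ cong (Σ +_) (trans (sum-map-const _ u) (cong (_* _) |u|≡3+k)) ⟩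
      Σ + (3 + k) * (length X ⊔ length Y)            ≤⟨ +-monoʳ-≤ Σ (k*[m⊔n]≤m*n k≤X k≤Y) ⟩
      Σ + length X * length Y                        ≡⟨ +-comm Σ _ ⟩
      length X * length Y + Σ                        ∎)

  reducible-colour : KSet (3 + k) u → Palette (3 + k) X → Palette (3 + k) Y → Disjoint X Y →
    All (KSet (3 + k)) W → Antichain W → length W < length X * length Y →
    Any (λ c → length (link c W) < length (X ∖ c) * length (Y ∖ c)) u
  reducible-colour {u = u} {X = X} {Y = Y} {W = W} ku pX pY X#Y kW antichain W<XY
    with Any.any? (λ c → length (link c W) <? length (X ∖ c) * length (Y ∖ c)) u
  ... | yes reducible = reducible
  ... | no none = contradiction
    (large-links⇒length≥ ku pX pY X#Y kW antichain (All.map ≮⇒≥ (¬Any⇒All¬ u none))) (<⇒≱ W<XY)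

  -- Precolourings

  Free : ∀ {n} → (Fin n → A) → A → A → A → Set a
  Free φ x y z = z ≢ x × z ≢ y × (∀ i → φ i ≢ z)

  ∉⇒Free : ∀ {n} {φ : Fin n → A} {x y} → z ∉ x ∷ y ∷ tabulate φ → Free φ x y z
  ∉⇒Free {φ = φ} z∉ = z∉ ∘ here , z∉ ∘ there ∘ here ,
    λ i φi≡z → z∉ (there (there (subst (_∈ tabulate φ) φi≡z (∈-tabulate⁺ i))))

  Palette⇒Any-Free : ∀ {n} {φ : Fin n → A} {x y} → Palette (3 + n) w → Any (Free φ x y) w
  Palette⇒Any-Free {φ = φ} (unique , 3+n≤w) =
    Any.map ∉⇒Free (Unique⇒Any∉ unique (≤-trans (≤-reflexive (cong (3 +_) (length-tabulate φ))) 3+n≤w))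

  -- φ colours K_n from the lists Q, x and y colour u₁ and u₂ from X and Y, and every list in W keeps a
  -- colour free for a vertex of the b-side.
  record Precolouring {n} (Q : Fin n → List A) (X Y : List A) (W : List (List A)) : Set a where
    field
      φ : Fin n → A
      x y : A
      φ∈Q : ∀ i → φ i ∈ Q i
      φ-proper : ∀ i j → i ≢ j → φ i ≢ φ j
      x∈X : x ∈ X
      y∈Y : y ∈ Y
      φ≢x : ∀ i → φ i ≢ x
      φ≢y : ∀ i → φ i ≢ y
      free : All (Any (Free φ x y)) W

  Precolouring-[] : ∀ {Q : Fin 0 → List A} {x y} → x ∈ X → y ∈ Y → All (Any (λ z → z ≢ x × z ≢ y)) W →
    Precolouring Q X Y W
  Precolouring-[] {x = x} {y = y} x∈X y∈Y free = record
    { φ = λ () ; x = x ; y = y ; φ∈Q = λ () ; φ-proper = λ () ; x∈X = x∈X ; y∈Y = y∈Y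
    ; φ≢x = λ () ; φ≢y = λ ()
    ; free = All.map (Any.map λ (z≢x , z≢y) → z≢x , z≢y , λ ()) free }

  Precolouring-∷ : ∀ {n} {Q : Fin (suc n) → List A} → c ∈ Q zero → All (Palette (3 + n)) W →
    Precolouring (λ i → Q (suc i) ∖ c) (X ∖ c) (Y ∖ c) (link c W) → Precolouring Q X Y W
  Precolouring-∷ {c} {W} {X} {Y} {n} {Q} c∈Q₀ palettes pc = record
    { φ = φ⁺ ; x = x ; y = y
    ; φ∈Q = λ { zero → c∈Q₀ ; (suc i) → proj₁ (∈-∖⁻ {u = Q (suc i)} (φ∈Q i)) }
    ; φ-proper = φ⁺-proper
    ; x∈X = proj₁ (∈-∖⁻ {u = X} x∈X) ; y∈Y = proj₁ (∈-∖⁻ {u = Y} y∈Y)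
    ; φ≢x = λ { zero → ≢-sym (proj₂ (∈-∖⁻ {u = X} x∈X)) ; (suc i) → φ≢x i }
    ; φ≢y = λ { zero → ≢-sym (proj₂ (∈-∖⁻ {u = Y} y∈Y)) ; (suc i) → φ≢y i }
    ; free = All.tabulate free⁺ }
    where
    open Precolouring pc
    φ⁺ : Fin (suc n) → A
    φ⁺ zero = c
    φ⁺ (suc i) = φ i
    φ≢c : ∀ i → φ i ≢ c
    φ≢c i = proj₂ (∈-∖⁻ {u = Q (suc i)} (φ∈Q i))
    φ⁺-proper : ∀ i j → i ≢ j → φ⁺ i ≢ φ⁺ j
    φ⁺-proper zero zero 0≢0 = contradiction refl 0≢0
    φ⁺-proper zero (suc j) _ = ≢-sym (φ≢c j)
    φ⁺-proper (suc i) zero _ = φ≢c i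
    φ⁺-proper (suc i) (suc j) i≢j = φ-proper i j (i≢j ∘ cong suc)
    Free⁺ : z ≢ c → Free φ x y z → Free φ⁺ x y z
    Free⁺ z≢c (z≢x , z≢y , φ≢z) = z≢x , z≢y , λ { zero → ≢-sym z≢c ; (suc i) → φ≢z i }
    free⁺ : w ∈ W → Any (Free φ⁺ x y) w
    free⁺ {w} w∈W with c ∈? w
    ... | yes c∈w =
      let z , z∈w∖c , z-free = find (All.lookup free (∈-link⁺ w∈W c∈w))
          z∈w , z≢c = ∈-∖⁻ {u = w} z∈w∖c
      in lose z∈w (Free⁺ z≢c z-free)
    ... | no c∉w =
      let z , z∈w , z-free = find (Palette⇒Any-Free (All.lookup palettes w∈W))
      in lose z∈w (Free⁺ (λ z≡c → c∉w (subst (_∈ w) z≡c z∈w)) z-free)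

  common-colour : ∀ n {Q : Fin n → List A} → c ∈ X → c ∈ Y → (∀ i → Palette (2 + n) (Q i)) →
    All (Palette (2 + n)) W → Precolouring Q X Y W
  common-colour {c = c} zero c∈X c∈Y _ palettes = Precolouring-[] c∈X c∈Y (All.map free palettes)
    where
    free : Palette 2 w → Any (λ z → z ≢ c × z ≢ c) w
    free (unique , 2≤w) =
      Any.map (λ z∉[c] → z∉[c] ∘ here , z∉[c] ∘ here) (Unique⇒Any∉ {v = c ∷ []} unique 2≤w)
  common-colour {c = c} (suc n) {Q} c∈X c∈Y palettes-Q palettes =
    let unique , 3+n≤Q₀ = palettes-Q zero
        d , d∈Q₀ , d∉[c] = find (Unique⇒Any∉ {v = c ∷ []} unique (≤-trans (s≤s (s≤s z≤n)) 3+n≤Q₀))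
        c≢d = d∉[c] ∘ here ∘ sym
    in Precolouring-∷ d∈Q₀ palettes
         (common-colour n (∈-∖⁺ c∈X c≢d) (∈-∖⁺ c∈Y c≢d) (λ i → Palette-∖ (palettes-Q (suc i)))
           (link-All (λ p _ → Palette-∖ p) palettes))

  pair-determined : ∀ {x y x′ y′} → Disjoint X Y → KSet 2 w → x ∈ X → y ∈ Y → x′ ∈ X → y′ ∈ Y →
    w ⊆ x ∷ y ∷ [] → w ⊆ x′ ∷ y′ ∷ [] → (x , y) ≡ (x′ , y′)
  pair-determined {X} {Y} {w} {x} {y} {x′} {y′} X#Y (unique-w , |w|≡2) x∈X y∈Y x′∈X y′∈Y
    w⊆xy w⊆x′y′ = cong₂ _,_ x≡x′ y≡y′
    where
    xy⊆x′y′ : x ∷ y ∷ [] ⊆ x′ ∷ y′ ∷ []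
    xy⊆x′y′ z∈ = w⊆x′y′ (⊆∧length≥⇒⊇ unique-w w⊆xy (≤-reflexive (sym |w|≡2)) z∈)
    x≡x′ : x ≡ x′
    x≡x′ with xy⊆x′y′ (here refl)
    ... | here x≡x′ = x≡x′
    ... | there (here x≡y′) = contradiction (x∈X , subst (_∈ Y) (sym x≡y′) y′∈Y) X#Y
    y≡y′ : y ≡ y′
    y≡y′ with xy⊆x′y′ (there (here refl))
    ... | here y≡x′ = contradiction (subst (_∈ X) (sym y≡x′) x′∈X , y∈Y) X#Y
    ... | there (here y≡y′) = y≡y′

  pair-free : Unique X → Unique Y → Disjoint X Y → All (KSet 2) W → length W < length X * length Y →
    ∃₂ λ x y → x ∈ X × y ∈ Y × All (Any (λ z → z ≢ x × z ≢ y)) W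
  pair-free {X} {Y} {W} unique-X unique-Y X#Y k₂W W<XY
    with Any.any? (λ (x , y) → All.all? (λ w → ¬? (w ⊆? x ∷ y ∷ [])) W) (cartesianProduct X Y)
  ... | yes found =
    let (x , y) , xy∈X×Y , unblocked = find found
        x∈X , y∈Y = ∈-cartesianProduct⁻ X Y xy∈X×Y
    in x , y , x∈X , y∈Y ,
       All.map (Any.map (λ z∉ → z∉ ∘ here , z∉ ∘ there ∘ here) ∘ ¬⊆⇒Any∉) unblocked
  ... | no none = contradiction W<XY (≤⇒≯ (begin
    length X * length Y            ≡⟨ length-cartesianProduct X Y ⟨
    length (cartesianProduct X Y)
      ≤⟨ injective-cover⇒length≤ (Unique.cartesianProduct⁺ unique-X unique-Y) blocked determined ⟩
    length W                       ∎))
    where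
    open ≤-Reasoning
    blocked : ∀ {x y} → (x , y) ∈ cartesianProduct X Y → Any (_⊆ x ∷ y ∷ []) W
    blocked xy∈ = Any.map (decidable-stable (_ ⊆? _))
      (¬All⇒Any¬ (λ w → ¬? (w ⊆? _)) W (All.lookup (¬Any⇒All¬ _ none) xy∈))
    determined : ∀ {p q w} → p ∈ cartesianProduct X Y → q ∈ cartesianProduct X Y → w ∈ W →
      w ⊆ proj₁ p ∷ proj₂ p ∷ [] → w ⊆ proj₁ q ∷ proj₂ q ∷ [] → p ≡ q
    determined p∈ q∈ w∈W =
      let x∈X , y∈Y = ∈-cartesianProduct⁻ X Y p∈
          x′∈X , y′∈Y = ∈-cartesianProduct⁻ X Y q∈
      in pair-determined X#Y (All.lookup k₂W w∈W) x∈X y∈Y x′∈X y′∈Y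

  take-KSet : Palette k u → KSet k (take k u)
  take-KSet {k} {u} (unique , k≤u) = Unique.take⁺ k unique , trans (length-take k u) (m≤n⇒m⊓n≡m k≤u)

  precolouring : ∀ n {Q : Fin n → List A} → (∀ i → Palette (2 + n) (Q i)) → Palette (2 + n) X →
    Palette (2 + n) Y → Disjoint X Y → All (KSet (2 + n)) W → Antichain W →
    length W < length X * length Y → Precolouring Q X Y W
  precolouring zero _ (unique-X , _) (unique-Y , _) X#Y k₂W _ W<XY =
    let x , y , x∈X , y∈Y , free = pair-free unique-X unique-Y X#Y k₂W W<XY
    in Precolouring-[] x∈X y∈Y free
  precolouring (suc n) {Q} palettes-Q palette-X palette-Y X#Y kW antichain W<XY =
    let c , c∈Q₀ , small-link =
          find (reducible-colour (take-KSet (palettes-Q zero)) palette-X palette-Y X#Y kW antichain W<XY)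
    in Precolouring-∷ (take⊆ (3 + n) (Q zero) c∈Q₀) (All.map KSet⇒Palette kW)
         (precolouring n (λ i → Palette-∖ (palettes-Q (suc i))) (Palette-∖ palette-X) (Palette-∖ palette-Y)
           (Disjoint-∖ X#Y)
           (link-All KSet-∖ kW) (link-Antichain antichain) small-link)

  shrink : ℕ → List (List A) → List (List A)
  shrink k W = deduplicate _⊆?_ (map (take k) W)

  shrink-KSet : All (Palette k) W → All (KSet k) (shrink k W)
  shrink-KSet palettes = Allₚ.deduplicate⁺ _⊆?_ (Allₚ.map⁺ (All.map take-KSet palettes))

  shrink-Antichain : ∀ k W → Antichain (shrink k W)
  shrink-Antichain k W = deduplicate-¬R _⊆?_ (map (take k) W)

  length-shrink : ∀ k W → length (shrink k W) ≤ length W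
  length-shrink k W =
    ≤-trans (length-deduplicate _⊆?_ (map (take k) W)) (≤-reflexive (length-map (take k) W))

  shrink-covers : ∀ k W → All (λ w → Any (_⊆ w) (shrink k W)) W
  shrink-covers k W = All.tabulate λ {w} w∈W →
    Anyₚ.deduplicate⁺ _⊆?_ (λ v⊆u u⊆w → u⊆w ∘ v⊆u) (lose (∈-map⁺ (take k) w∈W) (take⊆ k w))

  Precolouring-cover : ∀ {n} {Q : Fin n → List A} {W′} → All (λ w′ → Any (_⊆ w′) W) W′ →
    Precolouring Q X Y W → Precolouring Q X Y W′
  Precolouring-cover covered pc = record
    { φ = φ ; x = x ; y = y ; φ∈Q = φ∈Q ; φ-proper = φ-proper ; x∈X = x∈X ; y∈Y = y∈Y
    ; φ≢x = φ≢x ; φ≢y = φ≢y ; free = All.map free-in-cover covered }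
    where
    open Precolouring pc
    free-in-cover : ∀ {w′} → Any (_⊆ w′) _ → Any (Free φ x y) w′
    free-in-cover covered-w′ =
      let d , d∈W , d⊆w′ = find covered-w′ in Any-resp-⊆ d⊆w′ (All.lookup free d∈W)

  list-precolouring : ∀ n {Q : Fin n → List A} → (∀ i → Palette (2 + n) (Q i)) → Palette (2 + n) X →
    Palette (2 + n) Y → All (Palette (2 + n)) W → length W < (2 + n) * (2 + n) → Precolouring Q X Y W
  list-precolouring {X} {Y} {W} n palettes-Q palette-X palette-Y palettes W<k² with Any.any? (_∈? Y) X
  ... | yes common = let c , c∈X , c∈Y = find common in common-colour n c∈X c∈Y palettes-Q palettes
  ... | no disjoint = Precolouring-cover (shrink-covers (2 + n) W)
    (precolouring n palettes-Q palette-X palette-Y (λ (z∈X , z∈Y) → disjoint (lose z∈X z∈Y))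
      (shrink-KSet palettes) (shrink-Antichain (2 + n) W) (begin-strict
        length (shrink (2 + n) W)  ≤⟨ length-shrink (2 + n) W ⟩
        length W                   <⟨ W<k² ⟩
        (2 + n) * (2 + n)          ≤⟨ *-mono-≤ (proj₂ palette-X) (proj₂ palette-Y) ⟩
        length X * length Y        ∎))
    where open ≤-Reasoning


-- The graphs K_m ∨ K_{2,b}

open ListColouring ℕ._≟_

Proper : ∀ {C : Set} (G : Graph) → (V G → C) → Set
Proper G c = ∀ u v → Adj G u v → c u ≢ c v

χ-unique : ∀ {G k k′} → IsChromaticNumber G k → IsChromaticNumber G k′ → k ≡ k′
χ-unique {k = k} {k′} (colourable , minimal) (colourable′ , minimal′) with <-cmp k k′
... | tri< k<k′ _ _ = contradiction colourable (minimal′ k k<k′)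
... | tri≈ _ k≡k′ _ = k≡k′
... | tri> _ _ k′<k = contradiction colourable′ (minimal k′ k′<k)

clique-size-≤ : ∀ {G k} {c : V G → ℕ} → Proper G c → (f : Fin k → V G) →
  (∀ i j → i ≢ j → Adj G (f i) (f j)) → (F : List ℕ) → (∀ i → c (f i) ∈ F) → k ≤ length F
clique-size-≤ {k = k} {c} proper f adjacent F c∈F = begin
  k                          ≡⟨ length-tabulate (c ∘ f) ⟨
  length (tabulate (c ∘ f))  ≤⟨ Unique⇒length≤ (Unique.tabulate⁺ injective) tabulate⊆F ⟩
  length F                   ∎
  where
  open ≤-Reasoning
  injective : ∀ {i j} → c (f i) ≡ c (f j) → i ≡ j
  injective {i} {j} same-colour with i Fin.≟ j
  ... | yes i≡j = i≡j
  ... | no i≢j = contradiction same-colour (proper (f i) (f j) (adjacent i j i≢j))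
  tabulate⊆F : tabulate (c ∘ f) ⊆ F
  tabulate⊆F z∈ with i , refl ← ∈-tabulate⁻ z∈ = c∈F i

K∨K₂ : ℕ → ℕ → Graph
K∨K₂ m b = Join (K m) (KBip 2 b)

pattern κ i = inj₁ i
pattern u₁ = inj₂ (inj₁ zero)
pattern u₂ = inj₂ (inj₁ (suc zero))
pattern ω j = inj₂ (inj₂ j)

K∨K₂-proper : ∀ {m b} {C : Set} (c : V (K∨K₂ m b) → C) →
  (∀ i j → i ≢ j → c (κ i) ≢ c (κ j)) → (∀ i → c (κ i) ≢ c u₁) → (∀ i → c (κ i) ≢ c u₂) →
  (∀ i j → c (κ i) ≢ c (ω j)) → (∀ j → c u₁ ≢ c (ω j)) → (∀ j → c u₂ ≢ c (ω j)) →
  Proper (K∨K₂ m b) c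
K∨K₂-proper c κκ κu₁ κu₂ κω u₁ω u₂ω = proper
  where
  proper : Proper (K∨K₂ _ _) c
  proper (κ i) (κ j) i≢j = κκ i j i≢j
  proper (κ i) u₁ _ = κu₁ i
  proper (κ i) u₂ _ = κu₂ i
  proper (κ i) (ω j) _ = κω i j
  proper u₁ (κ i) _ = ≢-sym (κu₁ i)
  proper u₂ (κ i) _ = ≢-sym (κu₂ i)
  proper (ω j) (κ i) _ = ≢-sym (κω i j)
  proper u₁ (ω j) _ = u₁ω j
  proper u₂ (ω j) _ = u₂ω j
  proper (ω j) u₁ _ = ≢-sym (u₁ω j)
  proper (ω j) u₂ _ = ≢-sym (u₂ω j)
  proper (inj₂ (inj₁ _)) (inj₂ (inj₁ _)) ()
  proper (ω _) (ω _) ()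

anchor : ∀ {m b} → Fin (suc m) → V (K∨K₂ m b)
anchor zero = u₁
anchor (suc i) = κ i

clique : ∀ {m b} → Fin b → Fin (2 + m) → V (K∨K₂ m b)
clique j zero = ω j
clique j (suc p) = anchor p

clique-adjacent : ∀ {m b} (j : Fin b) p q → p ≢ q → Adj (K∨K₂ m b) (clique j p) (clique j q)
clique-adjacent j zero zero 0≢0 = contradiction refl 0≢0
clique-adjacent j zero (suc zero) _ = tt
clique-adjacent j zero (suc (suc _)) _ = tt
clique-adjacent j (suc zero) zero _ = tt
clique-adjacent j (suc (suc _)) zero _ = tt
clique-adjacent j (suc zero) (suc zero) 1≢1 = contradiction refl 1≢1
clique-adjacent j (suc zero) (suc (suc _)) _ = tt
clique-adjacent j (suc (suc _)) (suc zero) _ = tt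
clique-adjacent j (suc (suc i)) (suc (suc i′)) p≢q = p≢q ∘ cong (λ i → suc (suc i))

needs-2+m-colours : ∀ {m b} {c : V (K∨K₂ m (suc b)) → ℕ} → Proper (K∨K₂ m (suc b)) c → (F : List ℕ) →
  (∀ v → c v ∈ F) → 2 + m ≤ length F
needs-2+m-colours {m} {b} proper F c∈F =
  clique-size-≤ {G = K∨K₂ m (suc b)} proper (clique zero) (clique-adjacent zero) F (c∈F ∘ clique zero)

colourable : ∀ m b → Colorable (K∨K₂ m b) (2 + m)
colourable m b = colour , K∨K₂-proper colour
  (λ i j i≢j → i≢j ∘ Finₚ.suc-injective ∘ Finₚ.suc-injective) (λ _ ()) (λ _ ()) (λ _ _ ()) (λ _ ()) (λ _ ())
  where
  colour : V (K∨K₂ m b) → Fin (2 + m)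
  colour (κ i) = suc (suc i)
  colour (inj₂ (inj₁ _)) = zero
  colour (ω _) = suc zero

χ-K∨K₂ : ∀ m b → IsChromaticNumber (K∨K₂ m (suc b)) (2 + m)
χ-K∨K₂ m b = colourable m (suc b) , λ l l<2+m (c , proper) → <⇒≱ l<2+m
  (subst (2 + m ≤_) (length-upTo l)
    (needs-2+m-colours {c = toℕ ∘ c} (λ u v adj → proper u v adj ∘ Finₚ.toℕ-injective) (upTo l)
      (∈-upTo⁺ ∘ Finₚ.toℕ<n ∘ c)))

list-colouring : ∀ {m b} (L : V (K∨K₂ m b) → List ℕ) →
  Precolouring (L ∘ κ) (L u₁) (L u₂) (tabulate (L ∘ ω)) →
  ∃ λ c → (∀ v → c v ∈ L v) × Proper (K∨K₂ m b) c
list-colouring {m} {b} L pc = colour , colour∈L ,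
  K∨K₂-proper colour φ-proper φ≢x φ≢y (λ i j → proj₂ (proj₂ (free-colour j)) i)
    (≢-sym ∘ proj₁ ∘ free-colour) (≢-sym ∘ proj₁ ∘ proj₂ ∘ free-colour)
  where
  open Precolouring pc
  free-at : ∀ j → ∃ λ z → z ∈ L (ω j) × Free φ x y z
  free-at j = find (Allₚ.tabulate⁻ free j)
  colour : V (K∨K₂ m b) → ℕ
  colour (κ i) = φ i
  colour u₁ = x
  colour u₂ = y
  colour (ω j) = proj₁ (free-at j)
  free-colour : ∀ j → Free φ x y (colour (ω j))
  free-colour j = proj₂ (proj₂ (free-at j))
  colour∈L : ∀ v → colour v ∈ L v
  colour∈L (κ i) = φ∈Q i
  colour∈L u₁ = x∈X
  colour∈L u₂ = y∈Y
  colour∈L (ω j) = proj₁ (proj₂ (free-at j))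

choosable : ∀ n b → b < (2 + n) * (2 + n) → Choosable (K∨K₂ n b) (2 + n)
choosable n b b<k² L unique long = list-colouring L
  (list-precolouring n (palette ∘ κ) (palette u₁) (palette u₂) (Allₚ.tabulate⁺ (palette ∘ ω))
    (subst (_< (2 + n) * (2 + n)) (sym (length-tabulate (L ∘ ω))) b<k²))
  where
  palette : ∀ v → Palette (2 + n) (L v)
  palette v = unique v , long v

not-choosable-below : ∀ m b l → l < 2 + m → ¬ Choosable (K∨K₂ m (suc b)) l
not-choosable-below m b l l<2+m choosable =
  let c , c∈upTo , proper =
        choosable (λ _ → upTo l) (λ _ → Unique.upTo⁺ l) (λ _ → ≤-reflexive (sym (length-upTo l)))
  in <⇒≱ l<2+m (subst (2 + m ≤_) (length-upTo l) (needs-2+m-colours proper (upTo l) c∈upTo))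

χℓ-K∨K₂ : ∀ n b → suc b < (2 + n) * (2 + n) → IsListChromaticNumber (K∨K₂ n (suc b)) (2 + n)
χℓ-K∨K₂ n b b<k² = choosable n (suc b) b<k² , not-choosable-below n b

not-choosable : ∀ m b → (2 + m) * (2 + m) ≤ b → ¬ Choosable (K∨K₂ m b) (2 + m)
not-choosable m b k²≤b choosable =
  let c , c∈L , proper = choosable L (proj₁ ∘ palette) (proj₂ ∘ palette) in no-list-colouring c c∈L proper
  where
  k : ℕ
  k = 2 + m
  low : List ℕ
  low = upTo k
  unique-low : Unique low
  unique-low = Unique.upTo⁺ k
  |low|≡k : length low ≡ k
  |low|≡k = length-upTo k

  row : ℕ → ℕ → List ℕ
  row i t = (k + t) ∷ (low ∖ i)

  -- ω j gets row i t for j = t + i * k: whatever colour i ∈ low is missed by the K_m and u₁ and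
  -- whatever colour k + t is given to u₂, some ω j completes a k-clique with only low ∖ i left.
  L : V (K∨K₂ m b) → List ℕ
  L (κ _) = low
  L u₁ = low
  L u₂ = map (k +_) low
  L (ω j) = row (toℕ j / k) (toℕ j % k)

  row-palette : ∀ i t → Palette k (row i t)
  row-palette i t = k+t∉ ∷ ∖-Unique {c = i} unique-low ,
    ≤-trans (≤-reflexive (sym |low|≡k)) (length≤1+length-∖ {c = i} unique-low)
    where
    k+t∉ : All (k + t ≢_) (low ∖ i)
    k+t∉ = All.tabulate λ z∈ k+t≡z →
      <⇒≱ (∈-upTo⁻ (proj₁ (∈-∖⁻ {u = low} {c = i} z∈))) (subst (k ≤_) k+t≡z (m≤m+n k t))

  palette : ∀ v → Palette k (L v)
  palette (κ _) = unique-low , ≤-reflexive (sym |low|≡k)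
  palette u₁ = unique-low , ≤-reflexive (sym |low|≡k)
  palette u₂ = Unique.map⁺ (+-cancelˡ-≡ k _ _) unique-low ,
    ≤-reflexive (sym (trans (length-map (k +_) low) |low|≡k))
  palette (ω j) = row-palette (toℕ j / k) (toℕ j % k)

  anchor∈low : (c : V (K∨K₂ m b) → ℕ) → (∀ v → c v ∈ L v) → ∀ p → c (anchor p) ∈ low
  anchor∈low c c∈L zero = c∈L u₁
  anchor∈low c c∈L (suc i) = c∈L (κ i)

  no-list-colouring : (c : V (K∨K₂ m b) → ℕ) → (∀ v → c v ∈ L v) → Proper (K∨K₂ m b) c → ⊥
  no-list-colouring c c∈L proper
    with i , i∈low , i-unused ← find (Unique⇒Any∉ {v = tabulate (c ∘ anchor)} unique-low
                                 (subst₂ _<_ (sym (length-tabulate (c ∘ anchor))) (sym |low|≡k) ≤-refl))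
       | t , t∈low , c-u₂≡k+t ← ∈-map⁻ (k +_) (c∈L u₂)
    = <⇒≱ (subst (length (low ∖ i) <_) |low|≡k (length-∖<length unique-low i∈low))
        (clique-size-≤ {G = K∨K₂ m b} proper (clique j) (clique-adjacent j) (low ∖ i) clique-colours)
    where
    j<b : t + i * k < b
    j<b = begin-strict
      t + i * k  <⟨ +-monoˡ-< (i * k) (∈-upTo⁻ t∈low) ⟩
      k + i * k  ≤⟨ *-monoˡ-≤ k (∈-upTo⁻ i∈low) ⟩
      k * k      ≤⟨ k²≤b ⟩
      b          ∎
      where open ≤-Reasoning
    j : Fin b
    j = fromℕ< j<b
    L-at-j : L (ω j) ≡ row i t
    L-at-j rewrite Finₚ.toℕ-fromℕ< j<b =
      cong₂ row ([t+z*k]/k≡z i (∈-upTo⁻ t∈low)) ([t+z*k]%k≡t i (∈-upTo⁻ t∈low))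
    clique-colours : ∀ p → c (clique j p) ∈ low ∖ i
    clique-colours zero with subst (c (ω j) ∈_) L-at-j (c∈L (ω j))
    ... | here c-ω≡k+t = contradiction (trans c-ω≡k+t (sym c-u₂≡k+t)) (proper (ω j) u₂ tt)
    ... | there c-ω∈low∖i = c-ω∈low∖i
    clique-colours (suc p) = ∈-∖⁺ (anchor∈low c c∈L p)
      (λ c-p≡i → i-unused (subst (_∈ tabulate (c ∘ anchor)) c-p≡i (∈-tabulate⁺ {f = c ∘ anchor} p)))

corollary11 : ∀ (b s : ℕ) → 2 ≤ b → s * s ≤ b → b < suc s * suc s →
    IsOhbaNumber 2 b (s ∸ 1)
corollary11 b zero 2≤b _ b<1 = contradiction (≤-trans (s≤s z≤n) 2≤b) (<⇒≱ b<1)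
corollary11 (suc b) (suc n) _ s²≤b b<[s+1]² =
  (2 + n , χ-K∨K₂ n b , χℓ-K∨K₂ n b b<[s+1]²) , smaller-not-ChiEq
  where
  smaller-not-ChiEq : ∀ m → m < n → ¬ ChiEq (K∨K₂ m (suc b))
  smaller-not-ChiEq m m<n (k , χ≡k , χℓ≡k) =
    not-choosable m (suc b) (≤-trans (*-mono-≤ (s≤s m<n) (s≤s m<n)) s²≤b)
      (subst (Choosable (K∨K₂ m (suc b))) (χ-unique χ≡k (χ-K∨K₂ m b)) (proj₁ χℓ≡k))
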